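{- Let $\mathcal G$ be a PBDTP plabic graph with a fixed perfect orientation $\mathcal O$, and let $\epsilon^{(1)},\epsilon^{(2)}$ be two signatures on $\mathcal G$. Then $\epsilon^{(2)}$ is equivalent to $\epsilon^{(1)}$ if and only if, for every directed path $P$ from a boundary source to a boundary sink and for every closed directed cycle $C$, the sum of the signatures over the edges of $P$, respectively of $C$, has the same parity for $\epsilon^{(1)}$ and for $\epsilon^{(2)}$.
   Context: A plabic graph is a finite planar directed graph in a closed disc, no component disjoint from the boundary, with $n$ degree-one boundary vertices $b_1,\dots,b_n$ on the boundary circle, internal vertices of degree $2$ or $3$ in the open disc, and a perfect orientation: each internal vertex has exactly one incoming edge (white) or exactly one outgoing edge (black), bivalent vertices being assigned a colour. Sources/sinks: boundary vertices whose edge is outgoing/incoming. It is PBDTP if every edge lies on some directed path starting and ending at boundary vertices. A signature assigns to each edge $e$ (including edges at boundary vertices) a value $\epsilon_e\in\{0,1\}$. Signatures $\epsilon^{(1)},\epsilon^{(2)}$ are equivalent if there is $\eta:\{\text{internal vertices}\}\to\{0,1\}$ with $\epsilon^{(2)}_{U,V}\equiv\epsilon^{(1)}_{U,V}+\eta(U)+\eta(V)\pmod 2$ for every edge between internal vertices $U,V$ and $\epsilon^{(2)}_{U,V}\equiv\epsilon^{(1)}_{U,V}+\eta(U)\pmod 2$ for every edge joining an internal vertex $U$ to a boundary vertex $V$. -}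

module Defs where

open import Data.Nat using (ℕ; zero; suc; _+_; _*_; _≤_; _<_; _≤ᵇ_)
open import Data.Nat.DivMod using (_mod_)
open import Data.Fin using (Fin; toℕ) renaming (_≟_ to _≟F_)
open import Data.Bool using (Bool; true; false; _xor_; _∧_; not)
open import Data.Sum using (_⊎_; inj₁; inj₂)
open import Data.Sum.Properties using (≡-dec)
open import Data.Unit using (⊤; tt)
open import Data.Product using (Σ; _×_; _,_; ∃; ∃-syntax)
open import Data.List using (List; []; _∷_; length; filterᵇ; allFin; upTo; map; concatMap; _++_)
open import Data.Bool.ListAction using (and)
open import Relation.Nullary using (does)
open import Relation.Binary.PropositionalEquality using (_≡_)

-- Vertices of a plabic graph with nI internal and n boundary vertices:
-- inj₁ U = internal vertex U, inj₂ i = boundary vertex b_i.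

Vertex : ℕ → ℕ → Set
Vertex nI n = Fin nI ⊎ Fin n

_≟V_ : ∀ {nI n} → Vertex nI n → Vertex nI n → Bool
u ≟V v = does (≡-dec _≟F_ _≟F_ u v)

data Colour : Set where
  white black : Colour

countᵇ : ∀ {A : Set} → (A → Bool) → List A → ℕ
countᵇ p xs = length (filterᵇ p xs)

iter : ∀ {A : Set} → (A → A) → ℕ → A → A
iter f zero    x = x
iter f (suc k) x = f (iter f k x)

next : ∀ {n} → Fin n → Fin n
next {suc k} i = suc (toℕ i) mod suc k

-- The underlying directed graph (graph G with its perfect orientation O).
-- Edges are Fin m; edge e is directed from tail e to head e.

record DiGraph (n : ℕ) : Set where
  field
    nI   : ℕ
    m    : ℕ
    tail : Fin m → Vertex nI n
    head : Fin m → Vertex nI n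

  outdeg indeg deg : Vertex nI n → ℕ
  outdeg v = countᵇ (λ e → tail e ≟V v) (allFin m)
  indeg  v = countᵇ (λ e → head e ≟V v) (allFin m)
  deg    v = outdeg v + indeg v

  -- We add an auxiliary vertex ∞ outside
  -- the disc joined to every boundary vertex b_i by an auxiliary edge.
  -- Darts of the augmented graph: the two ends of each edge of G
  -- (true = tail end, false = head end) and the two ends of each
  -- auxiliary edge (true = end at ∞, false = end at b_i).

  Dart : Set
  Dart = (Fin m × Bool) ⊎ (Fin n × Bool)

  -- vertices of the augmented graph: inj₁ v = vertex of G, inj₂ tt = ∞
  dartVertex : Dart → Vertex nI n ⊎ ⊤
  dartVertex (inj₁ (e , true))  = inj₁ (tail e)
  dartVertex (inj₁ (e , false)) = inj₁ (head e)
  dartVertex (inj₂ (i , true))  = inj₂ tt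
  dartVertex (inj₂ (i , false)) = inj₁ (inj₂ i)

  α : Dart → Dart
  α (inj₁ (e , b)) = inj₁ (e , not b)
  α (inj₂ (i , b)) = inj₂ (i , not b)

  allDarts : List Dart
  allDarts = map (λ e → inj₁ (e , true)) (allFin m) ++ map (λ e → inj₁ (e , false)) (allFin m)
          ++ map (λ i → inj₂ (i , true)) (allFin n) ++ map (λ i → inj₂ (i , false)) (allFin n)

  dartIdx : Dart → ℕ
  dartIdx (inj₁ (e , true))  = 2 * toℕ e
  dartIdx (inj₁ (e , false)) = suc (2 * toℕ e)
  dartIdx (inj₂ (i , true))  = 2 * m + 2 * toℕ i
  dartIdx (inj₂ (i , false)) = suc (2 * m + 2 * toℕ i)

  -- number of orbits of a permutation π of the darts
  -- (= number of darts that are minimal in their orbit)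
  orbitCount : (Dart → Dart) → ℕ
  orbitCount π = countᵇ isMin allDarts
    where
    N = length allDarts
    isMin : Dart → Bool
    isMin d = and (map (λ k → dartIdx d ≤ᵇ dartIdx (iter π k d)) (upTo N))

-- A rotation system σ on the augmented graph realising a planar
-- embedding of G in the closed disc with boundary vertices b_1,…,b_n in
-- this cyclic order on the boundary circle: σ permutes the darts at each
-- vertex cyclically, the rotation at ∞ is b_1 → b_2 → … → b_n → b_1, and
-- the augmented map has genus 0 (Euler: V - E + F = 2, with faces the
-- orbits of σ ∘ α).  A graph without darts is trivially planar.
record DiscEmbedding {n : ℕ} (G : DiGraph n) : Set where
  open DiGraph G
  field
    σ       : Dart → Dart
    σ⁻¹     : Dart → Dart
    σ-inv₁  : ∀ d → σ (σ⁻¹ d) ≡ d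
    σ-inv₂  : ∀ d → σ⁻¹ (σ d) ≡ d
    σ-local : ∀ d → dartVertex (σ d) ≡ dartVertex d
    σ-cyclic : ∀ d d' → dartVertex d ≡ dartVertex d' → ∃[ k ] iter σ k d ≡ d'
    σ-∞     : ∀ i → σ (inj₂ (i , true)) ≡ inj₂ (next i , true)
    genus0  : (m + n ≡ 0) ⊎ (nI + n + 1 + orbitCount (λ d → σ (α d)) ≡ 2 + (m + n))

module _ {n : ℕ} (G : DiGraph n) where
  open DiGraph G

  -- directed walks (Postnikov's directed paths, self-intersections allowed)
  data Walk : Vertex nI n → Vertex nI n → Set where
    []  : ∀ {v} → Walk v v
    _∷_ : ∀ e {w} → Walk (head e) w → Walk (tail e) w

  data UWalk : Vertex nI n → Vertex nI n → Set where
    []   : ∀ {v} → UWalk v v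
    fwd  : ∀ e {w} → UWalk (head e) w → UWalk (tail e) w
    bwd  : ∀ e {w} → UWalk (tail e) w → UWalk (head e) w

record PlabicGraph (n : ℕ) : Set₁ where
  field
    graph : DiGraph n
  open DiGraph graph public
  field
    embedding   : DiscEmbedding graph
    colour      : Fin nI → Colour
    boundaryDeg : ∀ i → deg (inj₂ i) ≡ 1
    internalDeg : ∀ U → (deg (inj₁ U) ≡ 2) ⊎ (deg (inj₁ U) ≡ 3)
    perfect     : ∀ U → (colour U ≡ white → indeg (inj₁ U) ≡ 1)
                      × (colour U ≡ black → outdeg (inj₁ U) ≡ 1)
    noFloatingComponent : ∀ U → ∃[ i ] UWalk graph (inj₁ U) (inj₂ i)

module _ {n : ℕ} (G : PlabicGraph n) where
  open PlabicGraph G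

  IsSource IsSink : Fin n → Set
  IsSource i = outdeg (inj₂ i) ≡ 1
  IsSink   i = indeg (inj₂ i) ≡ 1

  -- PBDTP: every edge lies on a directed path from a boundary vertex to a
  -- boundary vertex
  IsPBDTP : Set
  IsPBDTP = ∀ e → ∃[ i ] ∃[ j ] (Walk graph (inj₂ i) (tail e) × Walk graph (head e) (inj₂ j))

  -- signatures: values in {0,1} = Bool (false = 0, true = 1), addition mod 2 = xor
  Signature : Set
  Signature = Fin m → Bool

  walkSum : Signature → ∀ {u v} → Walk graph u v → Bool
  walkSum ε []      = false
  walkSum ε (e ∷ w) = ε e xor walkSum ε w

  extend : (Fin nI → Bool) → Vertex nI n → Bool
  extend η (inj₁ U) = η U
  extend η (inj₂ i) = false

  Equivalent : Signature → Signature → Set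
  Equivalent ε₁ ε₂ = ∃[ η ] (∀ e → ε₂ e ≡ (ε₁ e xor extend η (tail e)) xor extend η (head e))

  -- same parity on every source-to-sink directed path and every closed
  -- directed cycle (a closed walk e ∷ w with w from head e back to tail e)
  SameParities : Signature → Signature → Set
  SameParities ε₁ ε₂ =
      (∀ i j → IsSource i → IsSink j → (P : Walk graph (inj₂ i) (inj₂ j)) → walkSum ε₁ P ≡ walkSum ε₂ P)
    × (∀ e → (C : Walk graph (head e) (tail e)) → walkSum ε₁ (e ∷ C) ≡ walkSum ε₂ (e ∷ C))

-- Put δ = ε₁ ⊕ ε₂.  Equivalence says exactly that δ is the coboundary
-- e ↦ η(tail e) ⊕ η(head e) of a vertex function η vanishing on the boundary,
-- and the δ-sum along a walk from u to v then telescopes to η(u) ⊕ η(v), which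
-- is 0 on source-to-sink paths and on cycles.  Conversely, if δ sums to 0 on
-- every source-to-sink path, then for each vertex U on a boundary-to-boundary
-- walk all walks from U to the boundary have the same δ-sum (namely that of
-- any walk from the boundary to U); this common value is η(U).  Since the
-- graph is PBDTP, each edge e lies on such a walk P · e · Q, and
-- δ e = η(tail e) ⊕ η(head e) by comparing the exits e · Q and Q.  (The cycle
-- condition is thus implied by the path condition.)
module Submission where

open import Defs
open import Data.Nat using (ℕ; _≤_; _<_)
open import Data.Nat.Properties using (≤-antisym; m≤m+n; m≤n+m)
open import Data.Fin using (Fin) renaming (_≟_ to _≟F_)
open import Data.Fin.Properties using (any?)
open import Data.Bool using (Bool; false; T; _xor_)
open import Data.Bool.Properties using (xor-assoc; xor-same; xor-identityʳ; xor-∧-commutativeRing; T?; T-≡)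
open import Algebra.Bundles using (CommutativeRing)
open import Algebra.Properties.CommutativeSemigroup
  (CommutativeRing.+-commutativeSemigroup xor-∧-commutativeRing) using (interchange)
open import Data.Sum using (inj₁; inj₂)
open import Data.Sum.Properties using (≡-dec)
open import Data.Product using (_×_; _,_; ∃-syntax; proj₂)
open import Data.List.Membership.Propositional.Properties using (∈-allFin; ∈-filter⁺; ∈-length)
open import Data.Empty using (⊥-elim)
open import Function using (_∘_)
open import Function.Bundles using (_⇔_; mk⇔; Equivalence)
open import Relation.Nullary using (yes; no)
open import Relation.Nullary.Decidable using (dec-true)
open import Relation.Binary.PropositionalEquality
  using (_≡_; _≢_; refl; sym; trans; cong; cong₂; subst; module ≡-Reasoning)
open ≡-Reasoning

xor-cancelˡ : ∀ x y → x xor (x xor y) ≡ y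
xor-cancelˡ x y = trans (sym (xor-assoc x x y)) (cong (_xor y) (xor-same x))

xor-cancelʳ : ∀ x y → (x xor y) xor y ≡ x
xor-cancelʳ x y = trans (xor-assoc x y y) (trans (cong (x xor_) (xor-same y)) (xor-identityʳ x))

≡xor⇔xor≡ : ∀ x y z → (y ≡ x xor z) ⇔ (x xor y ≡ z)
≡xor⇔xor≡ x y z = mk⇔
  (λ y≡ → trans (cong (x xor_) y≡) (xor-cancelˡ x z))
  (λ xy≡ → trans (sym (xor-cancelˡ x y)) (cong (x xor_) xy≡))

xor≡false⇒≡ : ∀ {x y} → x xor y ≡ false → x ≡ y
xor≡false⇒≡ {x} {y} xy≡ =
  sym (trans (Equivalence.from (≡xor⇔xor≡ x y false) xy≡) (xor-identityʳ x))

module _ {n : ℕ} (G : PlabicGraph n) where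
  open PlabicGraph G

  private
    V = Vertex nI n

  _++ʷ_ : ∀ {u v w} → Walk graph u v → Walk graph v w → Walk graph u w
  []      ++ʷ Q = Q
  (e ∷ P) ++ʷ Q = e ∷ (P ++ʷ Q)

  walkSum-++ : ∀ ε {u v w} (P : Walk graph u v) (Q : Walk graph v w)
             → walkSum G ε (P ++ʷ Q) ≡ walkSum G ε P xor walkSum G ε Q
  walkSum-++ ε []      Q = refl
  walkSum-++ ε (e ∷ P) Q = trans (cong (ε e xor_) (walkSum-++ ε P Q)) (sym (xor-assoc (ε e) _ _))

  _⊕_ : Signature G → Signature G → Signature G
  (ε₁ ⊕ ε₂) e = ε₁ e xor ε₂ e

  walkSum-⊕ : ∀ ε₁ ε₂ {u v} (P : Walk graph u v)
            → walkSum G (ε₁ ⊕ ε₂) P ≡ walkSum G ε₁ P xor walkSum G ε₂ P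
  walkSum-⊕ ε₁ ε₂ []      = refl
  walkSum-⊕ ε₁ ε₂ (e ∷ P) = trans (cong ((ε₁ ⊕ ε₂) e xor_) (walkSum-⊕ ε₁ ε₂ P))
                                  (interchange (ε₁ e) (ε₂ e) (walkSum G ε₁ P) (walkSum G ε₂ P))

  IsCoboundary : Signature G → (V → Bool) → Set
  IsCoboundary δ X = ∀ e → δ e ≡ X (tail e) xor X (head e)

  walkSum-coboundary : ∀ {δ} X → IsCoboundary δ X → ∀ {u v} (P : Walk graph u v)
                     → walkSum G δ P ≡ X u xor X v
  walkSum-coboundary X cob {u} []      = sym (xor-same (X u))
  walkSum-coboundary {δ} X cob {v = v} (e ∷ P) = begin
    δ e xor walkSum G δ P
      ≡⟨ cong₂ _xor_ (cob e) (walkSum-coboundary X cob P) ⟩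
    (X (tail e) xor X (head e)) xor (X (head e) xor X v)
      ≡⟨ xor-assoc (X (tail e)) _ _ ⟩
    X (tail e) xor (X (head e) xor (X (head e) xor X v))
      ≡⟨ cong (X (tail e) xor_) (xor-cancelˡ (X (head e)) (X v)) ⟩
    X (tail e) xor X v
      ∎

  ≟V-refl : ∀ (v : V) → T (v ≟V v)
  ≟V-refl v = Equivalence.from T-≡ (dec-true (≡-dec _≟F_ _≟F_ v v) refl)

  Leaves Enters : V → Set
  Leaves v = ∃[ e ] tail e ≡ v
  Enters v = ∃[ e ] head e ≡ v

  leaves-start : ∀ {u v} → Walk graph u v → u ≢ v → Leaves u
  leaves-start []      u≢u = ⊥-elim (u≢u refl)
  leaves-start (e ∷ _) _   = e , refl

  enters-along : ∀ {u v} → Walk graph u v → Enters u → Enters v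
  enters-along []      inc = inc
  enters-along (e ∷ P) _   = enters-along P (e , refl)

  outdeg-positive : ∀ {v} → Leaves v → 0 < outdeg v
  outdeg-positive (e , refl) =
    ∈-length (∈-filter⁺ (T? ∘ λ e′ → tail e′ ≟V tail e) (∈-allFin e) (≟V-refl (tail e)))

  indeg-positive : ∀ {v} → Enters v → 0 < indeg v
  indeg-positive (e , refl) =
    ∈-length (∈-filter⁺ (T? ∘ λ e′ → head e′ ≟V head e) (∈-allFin e) (≟V-refl (head e)))

  leaves-boundary⇒source : ∀ {i} → Leaves (inj₂ i) → IsSource G i
  leaves-boundary⇒source {i} out =
    ≤-antisym (subst (outdeg (inj₂ i) ≤_) (boundaryDeg i) (m≤m+n _ _)) (outdeg-positive out)

  enters-boundary⇒sink : ∀ {j} → Enters (inj₂ j) → IsSink G j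
  enters-boundary⇒sink {j} inc =
    ≤-antisym (subst (indeg (inj₂ j) ≤_) (boundaryDeg j) (m≤n+m _ _)) (indeg-positive inc)

  module _ (ε₁ ε₂ : Signature G) where

    equivalent⇔coboundary : Equivalent G ε₁ ε₂ ⇔ (∃[ η ] IsCoboundary (ε₁ ⊕ ε₂) (extend G η))
    equivalent⇔coboundary = mk⇔
      (λ (η , eq) → η , λ e → Equivalence.to (shift e η) (trans (eq e) (xor-assoc (ε₁ e) _ _)))
      (λ (η , cob) → η , λ e → trans (Equivalence.from (shift e η) (cob e)) (sym (xor-assoc (ε₁ e) _ _)))
      where
      shift : ∀ e η → let c = extend G η (tail e) xor extend G η (head e) in
              (ε₂ e ≡ ε₁ e xor c) ⇔ ((ε₁ ⊕ ε₂) e ≡ c)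
      shift e η = ≡xor⇔xor≡ (ε₁ e) (ε₂ e) _

    coboundary⇒sameParities : ∀ {η} → IsCoboundary (ε₁ ⊕ ε₂) (extend G η) → SameParities G ε₁ ε₂
    coboundary⇒sameParities {η} cob =
        (λ _ _ _ _ P → sameSum P (walkSum-coboundary (extend G η) cob P))
      , (λ e C → sameSum (e ∷ C) (trans (walkSum-coboundary (extend G η) cob (e ∷ C)) (xor-same (extend G η (tail e)))))
      where
      sameSum : ∀ {u v} (P : Walk graph u v) → walkSum G (ε₁ ⊕ ε₂) P ≡ false → walkSum G ε₁ P ≡ walkSum G ε₂ P
      sameSum P δP≡0 = xor≡false⇒≡ (trans (sym (walkSum-⊕ ε₁ ε₂ P)) δP≡0)

    sameParities⇒boundaryWalks : SameParities G ε₁ ε₂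
      → ∀ i j (P : Walk graph (inj₂ i) (inj₂ j)) → walkSum G (ε₁ ⊕ ε₂) P ≡ false
    sameParities⇒boundaryWalks (paths , _) i j P = vanish P refl refl
      where
      sourceToSink : ∀ {u v} → u ≡ inj₂ i → v ≡ inj₂ j → Leaves u → Enters v
                   → (P : Walk graph u v) → walkSum G (ε₁ ⊕ ε₂) P ≡ false
      sourceToSink refl refl out inc P =
        trans (walkSum-⊕ ε₁ ε₂ P)
          (trans (cong (_xor walkSum G ε₂ P) (paths i j (leaves-boundary⇒source out) (enters-boundary⇒sink inc) P))
                 (xor-same (walkSum G ε₂ P)))

      -- The endpoints are given by equations: splitting a walk whose start index is
      -- inj₂ i would require unifying tail e with inj₂ i.
      vanish : ∀ {u v} (P : Walk graph u v) → u ≡ inj₂ i → v ≡ inj₂ j → walkSum G (ε₁ ⊕ ε₂) P ≡ false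
      vanish []      _   _   = refl
      vanish (e ∷ P) u≡i v≡j = sourceToSink u≡i v≡j (e , refl) (enters-along P (e , refl)) (e ∷ P)

  OnBoundaryWalk : V → Set
  OnBoundaryWalk v = (∃[ i ] Walk graph (inj₂ i) v) × (∃[ j ] Walk graph v (inj₂ j))

  module _ (pbdtp : IsPBDTP G) (δ : Signature G)
           (δ-boundary : ∀ i j (P : Walk graph (inj₂ i) (inj₂ j)) → walkSum G δ P ≡ false) where

    leaves⇒onBoundaryWalk : ∀ {v} → Leaves v → OnBoundaryWalk v
    leaves⇒onBoundaryWalk (e , refl) with pbdtp e
    ... | i , j , P , Q = (i , P) , (j , e ∷ Q)

    exitSum-unique : ∀ {i v j k} → Walk graph (inj₂ i) v
                   → (Q : Walk graph v (inj₂ j)) (Q′ : Walk graph v (inj₂ k)) → walkSum G δ Q ≡ walkSum G δ Q′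
    exitSum-unique P Q Q′ = trans (sym (entry≡exit Q)) (entry≡exit Q′)
      where
      entry≡exit : ∀ {j} (Q : Walk graph _ (inj₂ j)) → walkSum G δ P ≡ walkSum G δ Q
      entry≡exit Q = xor≡false⇒≡ (trans (sym (walkSum-++ δ P Q)) (δ-boundary _ _ (P ++ʷ Q)))

    -- A vertex without outgoing edges lies on no walk to the boundary, so its value is irrelevant.
    potential : Fin nI → Bool
    potential U with any? (λ e → ≡-dec _≟F_ _≟F_ (tail e) (inj₁ U))
    ... | yes out = walkSum G δ (proj₂ (proj₂ (leaves⇒onBoundaryWalk out)))
    ... | no _    = false

    potential-exitSum : ∀ {v j} (Q : Walk graph v (inj₂ j)) → extend G potential v ≡ walkSum G δ Q
    potential-exitSum {inj₂ i} Q = sym (δ-boundary _ _ Q)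
    potential-exitSum {inj₁ U} Q with any? (λ e → ≡-dec _≟F_ _≟F_ (tail e) (inj₁ U))
    ... | yes out = let ((_ , P) , (_ , Q′)) = leaves⇒onBoundaryWalk out in exitSum-unique P Q′ Q
    ... | no no-out = ⊥-elim (no-out (leaves-start Q λ ()))

    potential-coboundary : IsCoboundary δ (extend G potential)
    potential-coboundary e with pbdtp e
    ... | _ , _ , _ , Q = begin
      δ e                                       ≡⟨ sym (xor-cancelʳ (δ e) (walkSum G δ Q)) ⟩
      (δ e xor walkSum G δ Q) xor walkSum G δ Q ≡⟨ sym (cong₂ _xor_ (potential-exitSum (e ∷ Q)) (potential-exitSum Q)) ⟩
      extend G potential (tail e) xor extend G potential (head e) ∎

mainTheorem6 : ∀ {n : ℕ} (G : PlabicGraph n) → IsPBDTP G → (ε₁ ε₂ : Signature G)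
    → Equivalent G ε₁ ε₂ ⇔ SameParities G ε₁ ε₂
mainTheorem6 G pbdtp ε₁ ε₂ = mk⇔
  (λ equiv → coboundary⇒sameParities G ε₁ ε₂ (proj₂ (to equiv)))
  (λ same → from (_ , potential-coboundary G pbdtp (_⊕_ G ε₁ ε₂) (sameParities⇒boundaryWalks G ε₁ ε₂ same)))
  where open Equivalence (equivalent⇔coboundary G ε₁ ε₂)
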